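{- For any double star graph $S_{1,n,n}$ on $2n+1$ vertices with $n\ge 1$, we have $\gamma_t(M(S_{1,n,n}))=2n$.
   Context: All graphs are finite and simple. The double star graph $S_{1,n,n}$ is obtained from the star $K_{1,n}$ (a central vertex joined to $n$ other vertices) by replacing every edge with a path of length $2$; i.e. it has vertices $v_0,v_1,\dots,v_{2n}$ and edges $v_0v_i$ and $v_iv_{n+i}$ for $1\le i\le n$. For a graph $H$ with no isolated vertices, a total dominating set of $H$ is a set $S\subseteq V(H)$ such that every vertex of $H$ has at least one neighbor in $S$; $\gamma_t(H)$ is the minimum cardinality of a total dominating set. The middle graph $M(G)$ of a graph $G$ has vertex set $V(G)\cup E(G)$ (disjoint union), and two of its vertices $x,y$ are adjacent exactly when either $x,y\in E(G)$ are edges of $G$ sharing a common endpoint, or $x\in V(G)$, $y\in E(G)$ and $x$ is an endpoint of $y$ (no two elements of $V(G)$ are adjacent in $M(G)$). -}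

module Defs where

open import Data.Nat using (ℕ; zero; suc; _+_; _*_; _≤_; _≡ᵇ_; _<ᵇ_; _≤ᵇ_)
open import Data.Fin using (Fin; toℕ)
open import Data.Bool using (Bool; true; false; T; _∧_; _∨_)
open import Data.Product using (Σ; ∃; _×_; _,_)
open import Data.Sum using (_⊎_; inj₁; inj₂)
open import Data.List using (List; length)
open import Data.List.Membership.Propositional using (_∈_)
open import Data.List.Relation.Unary.Unique.Propositional using (Unique)
open import Relation.Binary.PropositionalEquality using (_≡_)
open import Relation.Nullary using (¬_)

record Graph : Set₁ where
  field
    V   : Set
    Adj : V → V → Set

record SimpleGraph : Set where
  field
    order : ℕ
    adj   : Fin order → Fin order → Bool
    sym   : ∀ u v → adj u v ≡ adj v u
    irr   : ∀ v → adj v v ≡ false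

toGraph : SimpleGraph → Graph
toGraph G = record { V = Fin order ; Adj = λ u v → T (adj u v) }
  where open SimpleGraph G

-- Edges of a simple graph: pairs (u , v) with toℕ u < toℕ v and u adjacent to v
-- (each edge represented exactly once).
Edge : SimpleGraph → Set
Edge G = Σ (Fin order × Fin order) λ { (u , v) → T ((toℕ u <ᵇ toℕ v) ∧ adj u v) }
  where open SimpleGraph G

_isEndOf_ : {G : SimpleGraph} → Fin (SimpleGraph.order G) → Edge G → Set
x isEndOf ((u , v) , _) = (x ≡ u) ⊎ (x ≡ v)

MAdj : (G : SimpleGraph) → (Fin (SimpleGraph.order G) ⊎ Edge G)
                         → (Fin (SimpleGraph.order G) ⊎ Edge G) → Set
MAdj G (inj₁ x) (inj₁ y) = Data.Empty.⊥
  where import Data.Empty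
MAdj G (inj₁ x) (inj₂ e) = _isEndOf_ {G} x e
MAdj G (inj₂ e) (inj₁ x) = _isEndOf_ {G} x e
MAdj G (inj₂ e) (inj₂ f) = ¬ (e ≡ f) × ∃ λ x → _isEndOf_ {G} x e × _isEndOf_ {G} x f

middleGraph : SimpleGraph → Graph
middleGraph G = record { V = Fin (SimpleGraph.order G) ⊎ Edge G ; Adj = MAdj G }

IsTotalDominatingSet : (H : Graph) → List (Graph.V H) → Set
IsTotalDominatingSet H S = ∀ v → ∃ λ u → u ∈ S × Graph.Adj H v u

-- γ_t(H) = k : there is a total dominating set (a duplicate-free list, so
-- its length is its cardinality) of cardinality k, and every total
-- dominating set has cardinality at least k.
TotalDominationNumber≡ : (H : Graph) → ℕ → Set
TotalDominationNumber≡ H k =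
  (∃ λ S → Unique S × IsTotalDominatingSet H S × length S ≡ k)
  × (∀ S → Unique S → IsTotalDominatingSet H S → k ≤ length S)

-- Double star S_{1,n,n}: vertices v_0,…,v_{2n} (v_i = the element of
-- Fin (2n+1) with toℕ = i); edges v_0 v_i and v_i v_{n+i} for 1 ≤ i ≤ n.
dsEdge : ℕ → ℕ → ℕ → Bool
dsEdge n a b = ((a ≡ᵇ 0) ∧ ((1 ≤ᵇ b) ∧ (b ≤ᵇ n)))
             ∨ ((1 ≤ᵇ a) ∧ ((a ≤ᵇ n) ∧ (b ≡ᵇ (a + n))))

dsAdj : ℕ → ℕ → ℕ → Bool
dsAdj n a b = dsEdge n a b ∨ dsEdge n b a

private
  open import Data.Bool.Properties using (∨-comm; ∧-zeroʳ)
  open import Relation.Binary.PropositionalEquality using (refl; cong; trans)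

  ≡ᵇ-+suc : ∀ a m → (a ≡ᵇ (a + suc m)) ≡ false
  ≡ᵇ-+suc zero m = refl
  ≡ᵇ-+suc (suc a) m = ≡ᵇ-+suc a m

  dsEdge-irr : ∀ n a → dsEdge n a a ≡ false
  dsEdge-irr n zero = refl
  dsEdge-irr zero (suc a) = refl
  dsEdge-irr (suc m) (suc a) =
    trans (cong ((suc a ≤ᵇ suc m) ∧_) (≡ᵇ-+suc a m)) (∧-zeroʳ (suc a ≤ᵇ suc m))

doubleStar : ℕ → SimpleGraph
doubleStar n = record
  { order = suc (2 * n)
  ; adj   = λ u v → dsAdj n (toℕ u) (toℕ v)
  ; sym   = λ u v → ∨-comm (dsEdge n (toℕ u) (toℕ v)) (dsEdge n (toℕ v) (toℕ u))
  ; irr   = λ v → trans (cong (λ b → b ∨ dsEdge n (toℕ v) (toℕ v)) (dsEdge-irr n (toℕ v)))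
                        (dsEdge-irr n (toℕ v))
  }

-- Lower bound: in M(S_{1,n,n}) the leaves v_{n+i} and the pendant edges v_i v_{n+i}
-- form an open packing, N(v_{n+i}) = {v_i v_{n+i}} and N(v_i v_{n+i}) = {v_i, v_{n+i}, v_0 v_i},
-- so a total dominating set needs a distinct member for each of these 2n vertices.
-- Disjointness is certified by a labelling of V(M) that is constant on each of these
-- neighbourhoods. Upper bound: the 2n edges of S_{1,n,n} totally dominate M, since every
-- vertex lies on an edge and every edge shares an endpoint with another one (n ≥ 1).

module Submission where

open import Defs
open import Data.Nat using (ℕ; zero; suc; _+_; _*_; _∸_; _≤_; _<_; _<ᵇ_; pred; z≤n; s≤s; z<s; _<?_; _≤?_)
open import Data.Nat.Properties
open import Data.Fin using (Fin; toℕ; fromℕ<; remQuot; combine)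
open import Data.Fin.Patterns using (0F; 1F)
open import Data.Fin.Properties using (toℕ-fromℕ<; toℕ-injective; toℕ<n; injective⇒≤; combine-remQuot; remQuot-combine)
open import Data.Bool using (T; _∧_)
open import Data.Bool.Properties using (T-∧; T-∨; T-irrelevant)
open import Data.Product using (∃; _×_; _,_; proj₁; proj₂; uncurry)
open import Data.Sum using (_⊎_; inj₁; inj₂; [_,_]′; fromInj₁)
import Data.Sum as Sum
open import Data.List using (List; length; tabulate; lookup)
open import Data.List.Properties using (length-tabulate)
open import Data.List.Membership.Propositional using (_∈_)
open import Data.List.Membership.Propositional.Properties using (∈-tabulate⁺)
open import Data.List.Relation.Unary.Any using (index)
open import Data.List.Relation.Unary.Any.Properties using (lookup-index)
open import Data.List.Relation.Unary.Unique.Propositional using (Unique)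
open import Data.List.Relation.Unary.Unique.Propositional.Properties using (tabulate⁺)
open import Function using (_∘_)
open import Function.Bundles using (Equivalence)
open import Relation.Binary.PropositionalEquality
open import Relation.Nullary using (¬_; yes; no; contradiction)

open Equivalence using (to; from)

remQuot-injective : ∀ {m} n {i j : Fin (m * n)} → remQuot {m} n i ≡ remQuot n j → i ≡ j
remQuot-injective {m} n {i} {j} eq = begin
  i                                 ≡⟨ combine-remQuot {m} n i ⟨
  uncurry combine (remQuot {m} n i) ≡⟨ cong (uncurry combine) eq ⟩
  uncurry combine (remQuot {m} n j) ≡⟨ combine-remQuot {m} n j ⟩
  j                                 ∎
  where open ≡-Reasoning

module _ (H : Graph) where
  open Graph H

  IsOpenPacking : ∀ {k} → (Fin k → V) → Set
  IsOpenPacking w = ∀ {i j u} → Adj (w i) u → Adj (w j) u → i ≡ j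

  openPacking-≤-length : ∀ {k} {w : Fin k → V} → IsOpenPacking w →
                         ∀ {S} → IsTotalDominatingSet H S → k ≤ length S
  openPacking-≤-length {k} {w} packing {S} dominates = injective⇒≤ dominatorIndex-injective
    where
    dominatorIndex : Fin k → Fin (length S)
    dominatorIndex i = index (proj₁ (proj₂ (dominates (w i))))

    dominator-adj : ∀ i → Adj (w i) (lookup S (dominatorIndex i))
    dominator-adj i with dominates (w i)
    ... | u , u∈S , adj = subst (Adj (w i)) (lookup-index u∈S) adj

    dominatorIndex-injective : ∀ {i j} → dominatorIndex i ≡ dominatorIndex j → i ≡ j
    dominatorIndex-injective {i} {j} eq =
      packing (dominator-adj i) (subst (Adj (w j) ∘ lookup S) (sym eq) (dominator-adj j))

module DoubleStar (n : ℕ) where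

  G : SimpleGraph
  G = doubleStar n

  Vertex : Set
  Vertex = Fin (suc (2 * n))

  src tgt : Edge G → Vertex
  src ((u , _) , _) = u
  tgt ((_ , v) , _) = v

  _∈ends_ : Vertex → Edge G → Set
  x ∈ends e = _isEndOf_ {G} x e

  -- j : Fin n stands for the paper's index i = j + 1.
  data IsEdge : ℕ → ℕ → Set where
    spoke   : (j : Fin n) → IsEdge 0 (suc (toℕ j))
    pendant : (j : Fin n) → IsEdge (suc (toℕ j)) (suc (toℕ j) + n)

  spoke′ : ∀ {b} → b < n → IsEdge 0 (suc b)
  spoke′ b<n = subst (IsEdge 0 ∘ suc) (toℕ-fromℕ< b<n) (spoke (fromℕ< b<n))

  pendant′ : ∀ {a} → a < n → IsEdge (suc a) (suc a + n)
  pendant′ a<n = subst (λ c → IsEdge (suc c) (suc c + n)) (toℕ-fromℕ< a<n) (pendant (fromℕ< a<n))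

  dsEdge⇒IsEdge : ∀ a b → T (dsEdge n a b) → IsEdge a b
  dsEdge⇒IsEdge zero    zero    ()
  dsEdge⇒IsEdge zero    (suc b) t = spoke′ (<ᵇ⇒< b n (fromInj₁ (λ ()) (T-∨ .to t)))
  dsEdge⇒IsEdge (suc a) b       t with a<n , b≡ ← T-∧ .to t with refl ← ≡ᵇ⇒≡ b (suc a + n) b≡ =
    pendant′ (<ᵇ⇒< a n a<n)

  IsEdge⇒dsEdge : ∀ {a b} → IsEdge a b → T (dsEdge n a b)
  IsEdge⇒dsEdge (spoke j)   = T-∨ .from (inj₁ (<⇒<ᵇ (toℕ<n j)))
  IsEdge⇒dsEdge (pendant j) = T-∧ .from (<⇒<ᵇ (toℕ<n j) , ≡⇒≡ᵇ (suc (toℕ j) + n) _ refl)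

  IsEdge⇒< : ∀ {a b} → IsEdge a b → a < b
  IsEdge⇒< (spoke j)   = z<s
  IsEdge⇒< (pendant j) = m<m+n (suc (toℕ j)) (≤-<-trans z≤n (toℕ<n j))

  IsEdge⇒<order : ∀ {a b} → IsEdge a b → b < suc (2 * n)
  IsEdge⇒<order (spoke j)   = s≤s (≤-trans (toℕ<n j) (m≤m+n n (n + 0)))
  IsEdge⇒<order (pendant j) = s≤s (+-mono-≤ (toℕ<n j) (m≤m+n n 0))

  EdgeCondition : ℕ → ℕ → Set
  EdgeCondition a b = T ((a <ᵇ b) ∧ dsAdj n a b)

  EdgeCondition⇒IsEdge : ∀ a b → EdgeCondition a b → IsEdge a b
  EdgeCondition⇒IsEdge a b t with a<b , adj ← T-∧ .to t = [ dsEdge⇒IsEdge a b , not-reversed ]′ (T-∨ .to adj)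
    where
    not-reversed : T (dsEdge n b a) → IsEdge a b
    not-reversed ba = contradiction (IsEdge⇒< (dsEdge⇒IsEdge b a ba)) (<⇒≯ (<ᵇ⇒< a b a<b))

  IsEdge⇒EdgeCondition : ∀ {a b} → IsEdge a b → EdgeCondition a b
  IsEdge⇒EdgeCondition d = T-∧ .from (<⇒<ᵇ (IsEdge⇒< d) , T-∨ .from (inj₁ (IsEdge⇒dsEdge d)))

  isEdge : (e : Edge G) → IsEdge (toℕ (src e)) (toℕ (tgt e))
  isEdge ((u , v) , t) = EdgeCondition⇒IsEdge (toℕ u) (toℕ v) t

  toEdge : ∀ {a b} → IsEdge a b → Edge G
  toEdge d = (fromℕ< a<order , fromℕ< b<order) ,
    subst₂ EdgeCondition (sym (toℕ-fromℕ< a<order)) (sym (toℕ-fromℕ< b<order)) (IsEdge⇒EdgeCondition d)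
    where
    b<order = IsEdge⇒<order d
    a<order = <-trans (IsEdge⇒< d) b<order

  toℕ-src-toEdge : ∀ {a b} (d : IsEdge a b) → toℕ (src (toEdge d)) ≡ a
  toℕ-src-toEdge d = toℕ-fromℕ< _

  toℕ-tgt-toEdge : ∀ {a b} (d : IsEdge a b) → toℕ (tgt (toEdge d)) ≡ b
  toℕ-tgt-toEdge d = toℕ-fromℕ< _

  Edge-≡ : ∀ {e f : Edge G} → toℕ (src e) ≡ toℕ (src f) → toℕ (tgt e) ≡ toℕ (tgt f) → e ≡ f
  Edge-≡ {(u , v) , p} {(u′ , v′) , q} u≡ v≡
    with refl ← toℕ-injective u≡ | refl ← toℕ-injective v≡ = cong ((u , v) ,_) (T-irrelevant p q)

  spokeEdge pendantEdge : Fin n → Edge G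
  spokeEdge   = toEdge ∘ spoke
  pendantEdge = toEdge ∘ pendant

  leaf : Fin n → Vertex
  leaf = tgt ∘ pendantEdge

  inner≢leaf : ∀ (i j : Fin n) → suc (toℕ i) ≢ suc (toℕ j) + n
  inner≢leaf i j eq = <⇒≱ (toℕ<n i) (subst (n ≤_) (sym (suc-injective eq)) (m≤n+m n (toℕ j)))

  labelVertex : ℕ → Fin 2 × ℕ
  labelVertex a with a ≤? n
  ... | yes _ = 1F , pred a
  ... | no  _ = 1F , pred a ∸ n

  labelEdge : ℕ → ℕ → Fin 2 × ℕ
  labelEdge zero    b = 1F , pred b
  labelEdge (suc a) _ = 0F , a

  label : Vertex ⊎ Edge G → Fin 2 × ℕ
  label (inj₁ x) = labelVertex (toℕ x)
  label (inj₂ e) = labelEdge (toℕ (src e)) (toℕ (tgt e))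

  tag : Fin 2 × Fin n → Fin 2 × ℕ
  tag (i , j) = i , toℕ j

  tag∘remQuot-injective : ∀ {k k′ : Fin (2 * n)} → tag (remQuot n k) ≡ tag (remQuot n k′) → k ≡ k′
  tag∘remQuot-injective eq = remQuot-injective n (cong₂ _,_ (cong proj₁ eq) (toℕ-injective (cong proj₂ eq)))

  labelVertex-inner : ∀ (j : Fin n) → labelVertex (suc (toℕ j)) ≡ (1F , toℕ j)
  labelVertex-inner j with suc (toℕ j) ≤? n
  ... | yes _   = refl
  ... | no  j≮n = contradiction (toℕ<n j) j≮n

  labelVertex-leaf : ∀ (j : Fin n) → labelVertex (suc (toℕ j) + n) ≡ (1F , toℕ j)
  labelVertex-leaf j with suc (toℕ j) + n ≤? n
  ... | yes leaf≤n = contradiction leaf≤n (<⇒≱ (m<n+m n z<s))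
  ... | no  _      = cong (1F ,_) (m+n∸n≡m (toℕ j) n)

  label-toEdge : ∀ {a b} (d : IsEdge a b) → label (inj₂ (toEdge d)) ≡ labelEdge a b
  label-toEdge d = cong₂ labelEdge (toℕ-src-toEdge d) (toℕ-tgt-toEdge d)

  toℕ-endpoint : ∀ {x} e → x ∈ends e → toℕ x ≡ toℕ (src e) ⊎ toℕ x ≡ toℕ (tgt e)
  toℕ-endpoint e = Sum.map (cong toℕ) (cong toℕ)

  toℕ-endpoint-toEdge : ∀ {x a b} (d : IsEdge a b) → x ∈ends toEdge d → toℕ x ≡ a ⊎ toℕ x ≡ b
  toℕ-endpoint-toEdge d = Sum.map (λ eq → trans eq (toℕ-src-toEdge d)) (λ eq → trans eq (toℕ-tgt-toEdge d))
                        ∘ toℕ-endpoint (toEdge d)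

  leaf-neighbour-label : ∀ {a b c} (j : Fin n) → IsEdge a b → c ≡ a ⊎ c ≡ b →
                         c ≡ suc (toℕ j) + n → labelEdge a b ≡ (0F , toℕ j)
  leaf-neighbour-label j (spoke i)   (inj₁ ())  refl
  leaf-neighbour-label j (spoke i)   (inj₂ eq)  refl = contradiction (sym eq) (inner≢leaf i j)
  leaf-neighbour-label j (pendant i) (inj₁ eq)  refl = contradiction (sym eq) (inner≢leaf i j)
  leaf-neighbour-label j (pendant i) (inj₂ eq)  refl =
    cong (0F ,_) (suc-injective (+-cancelʳ-≡ _ _ _ (sym eq)))

  pendant-neighbour-label : ∀ {a b c} (j : Fin n) → IsEdge a b →
                            ¬ (a ≡ suc (toℕ j) × b ≡ suc (toℕ j) + n) →
                            c ≡ a ⊎ c ≡ b → c ≡ suc (toℕ j) ⊎ c ≡ suc (toℕ j) + n →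
                            labelEdge a b ≡ (1F , toℕ j)
  pendant-neighbour-label j (spoke i)   _ (inj₁ refl) (inj₁ ())
  pendant-neighbour-label j (spoke i)   _ (inj₁ refl) (inj₂ ())
  pendant-neighbour-label j (spoke i)   _ (inj₂ refl) (inj₁ eq) = cong (1F ,_) (suc-injective eq)
  pendant-neighbour-label j (spoke i)   _ (inj₂ refl) (inj₂ eq) = contradiction eq (inner≢leaf i j)
  pendant-neighbour-label j (pendant i) ≢ (inj₁ refl) (inj₁ eq) = contradiction (eq , cong (_+ n) eq) ≢
  pendant-neighbour-label j (pendant i) _ (inj₁ refl) (inj₂ eq) = contradiction eq (inner≢leaf i j)
  pendant-neighbour-label j (pendant i) _ (inj₂ refl) (inj₁ eq) = contradiction (sym eq) (inner≢leaf j i)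
  pendant-neighbour-label j (pendant i) ≢ (inj₂ refl) (inj₂ eq) =
    contradiction (inner≡ , cong (_+ n) inner≡) ≢
    where inner≡ = +-cancelʳ-≡ _ _ _ eq

  witness : Fin 2 × Fin n → Vertex ⊎ Edge G
  witness (0F , j) = inj₁ (leaf j)
  witness (1F , j) = inj₂ (pendantEdge j)

  witness-neighbour-label : ∀ w {u} → MAdj G (witness w) u → label u ≡ tag w
  witness-neighbour-label (0F , j) {inj₂ f} leaf∈f =
    leaf-neighbour-label j (isEdge f) (toℕ-endpoint f leaf∈f) (toℕ-tgt-toEdge (pendant j))
  witness-neighbour-label (1F , j) {inj₁ x} x∈p =
    [ (λ eq → trans (cong labelVertex eq) (labelVertex-inner j))
    , (λ eq → trans (cong labelVertex eq) (labelVertex-leaf j)) ]′ (toℕ-endpoint-toEdge (pendant j) x∈p)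
  witness-neighbour-label (1F , j) {inj₂ f} (p≢f , z , z∈p , z∈f) =
    pendant-neighbour-label j (isEdge f) f≢p (toℕ-endpoint f z∈f) (toℕ-endpoint-toEdge (pendant j) z∈p)
    where
    f≢p : ¬ (toℕ (src f) ≡ suc (toℕ j) × toℕ (tgt f) ≡ suc (toℕ j) + n)
    f≢p (src≡ , tgt≡) = p≢f (Edge-≡ (trans (toℕ-src-toEdge (pendant j)) (sym src≡))
                                     (trans (toℕ-tgt-toEdge (pendant j)) (sym tgt≡)))

  witnesses-openPacking : IsOpenPacking (middleGraph G) (witness ∘ remQuot n)
  witnesses-openPacking adj adj′ =
    tag∘remQuot-injective (trans (sym (witness-neighbour-label _ adj)) (witness-neighbour-label _ adj′))

  data VertexView : ℕ → Set where
    isCentre : VertexView 0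
    isInner  : (j : Fin n) → VertexView (suc (toℕ j))
    isLeaf   : (j : Fin n) → VertexView (suc (toℕ j) + n)

  vertexView : ∀ {a} → a < suc (2 * n) → VertexView a
  vertexView {zero}  _ = isCentre
  vertexView {suc a} (s≤s a<2n) with a <? n
  ... | yes a<n = subst (VertexView ∘ suc) (toℕ-fromℕ< a<n) (isInner (fromℕ< a<n))
  ... | no  a≮n = subst VertexView (cong suc (trans (cong (_+ n) (toℕ-fromℕ< a∸n<n)) (m∸n+n≡m n≤a)))
                        (isLeaf (fromℕ< a∸n<n))
    where
    n≤a = ≮⇒≥ a≮n
    a∸n<n : a ∸ n < n
    a∸n<n = +-cancelˡ-< n _ _
              (subst₂ _<_ (sym (m+[n∸m]≡n n≤a)) (cong (n +_) (+-identityʳ n)) a<2n)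

  dominator : Fin 2 × Fin n → Edge G
  dominator (0F , j) = pendantEdge j
  dominator (1F , j) = spokeEdge j

  label-dominator : ∀ w → label (inj₂ (dominator w)) ≡ tag w
  label-dominator (0F , j) = label-toEdge (pendant j)
  label-dominator (1F , j) = label-toEdge (spoke j)

  dominators : List (Vertex ⊎ Edge G)
  dominators = tabulate (inj₂ ∘ dominator ∘ remQuot n)

  dominators-unique : Unique dominators
  dominators-unique = tabulate⁺ λ eq →
    tag∘remQuot-injective (trans (sym (label-dominator _)) (trans (cong label eq) (label-dominator _)))

  dominator∈dominators : ∀ w → inj₂ (dominator w) ∈ dominators
  dominator∈dominators (i , j) =
    subst (λ w → inj₂ (dominator w) ∈ dominators) (remQuot-combine i j) (∈-tabulate⁺ (combine i j))

  vertex-dominated : 1 ≤ n → ∀ {a} → VertexView a →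
                     ∃ λ w → a ≡ toℕ (src (dominator w)) ⊎ a ≡ toℕ (tgt (dominator w))
  vertex-dominated n≥1 isCentre    = (1F , fromℕ< n≥1) , inj₁ (sym (toℕ-src-toEdge (spoke (fromℕ< n≥1))))
  vertex-dominated _   (isInner j) = (1F , j) , inj₂ (sym (toℕ-tgt-toEdge (spoke j)))
  vertex-dominated _   (isLeaf j)  = (0F , j) , inj₂ (sym (toℕ-tgt-toEdge (pendant j)))

  edges-adjacent : ∀ {e f} z → z ∈ends e → z ∈ends f → toℕ (src e) ≢ toℕ (src f) →
                   MAdj G (inj₂ e) (inj₂ f)
  edges-adjacent z z∈e z∈f src≢ = src≢ ∘ cong (toℕ ∘ src) , z , z∈e , z∈f

  edge-dominated : ∀ f {a b} → IsEdge a b → toℕ (src f) ≡ a → toℕ (tgt f) ≡ b →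
                   ∃ λ w → MAdj G (inj₂ f) (inj₂ (dominator w))
  edge-dominated f (spoke j) src≡ tgt≡ = (0F , j) ,
    edges-adjacent (tgt f) (inj₂ refl) (inj₁ (toℕ-injective (trans tgt≡ (sym (toℕ-src-toEdge (pendant j))))))
      (λ eq → 0≢1+n (trans (sym src≡) (trans eq (toℕ-src-toEdge (pendant j)))))
  edge-dominated f (pendant j) src≡ tgt≡ = (1F , j) ,
    edges-adjacent (src f) (inj₁ refl) (inj₂ (toℕ-injective (trans src≡ (sym (toℕ-tgt-toEdge (spoke j))))))
      (λ eq → 0≢1+n (trans (sym (toℕ-src-toEdge (spoke j))) (trans (sym eq) src≡)))

  dominated : 1 ≤ n → ∀ v → ∃ λ w → MAdj G v (inj₂ (dominator w))
  dominated n≥1 (inj₁ x) with w , x∈ ← vertex-dominated n≥1 (vertexView (toℕ<n x)) =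
    w , Sum.map toℕ-injective toℕ-injective x∈
  dominated _   (inj₂ f) = edge-dominated f (isEdge f) refl refl

  dominators-dominate : 1 ≤ n → IsTotalDominatingSet (middleGraph G) dominators
  dominators-dominate n≥1 v with w , adj ← dominated n≥1 v =
    inj₂ (dominator w) , dominator∈dominators w , adj

proposition2p5 : ∀ (n : ℕ) → 1 ≤ n →
    TotalDominationNumber≡ (middleGraph (doubleStar n)) (2 * n)
proposition2p5 n n≥1 =
  (dominators , dominators-unique , dominators-dominate n≥1 , length-tabulate _) ,
  λ _ _ dominates → openPacking-≤-length (middleGraph G) witnesses-openPacking dominates
  where open DoubleStar n
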